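{- Let $c=(c_1,\dots,c_k)$ be a composition with $k\ge2$, and let $c^1=(c_1+c_2,c_3,\dots,c_k)$ and $c^L=(c_2,\dots,c_k)$. Then \[ g_c(q)=\frac{1}{c_1}g_{c^1}(q)-\frac{q^{c_1}}{c_1}g_{c^L}(q). \]
   Context: For a composition $c=(c_1,\dots,c_k)$ (positive integers), the composition polynomial is \[ g_c(q) := \int_{q}^{1} \int_{q}^{t_k} \cdots \int_{q}^{t_2} t_1^{c_1-1}\cdots t_k^{c_k-1}\, dt_1\cdots dt_k . \]
   Formalization: The variable q of $g_c(q)$ ranges over the rationals. -}

module Defs where

open import Data.Nat as ℕ using (ℕ; zero; suc)
open import Data.Integer using (+_)
open import Data.Rational using (ℚ; _/_; 0ℚ; 1ℚ; _+_; _*_; _-_; -_)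
open import Data.List using (List; []; _∷_; foldl; map; concatMap)
open import Data.Product using (_×_; _,_)

pow : ℚ → ℕ → ℚ
pow q zero = 1ℚ
pow q (suc n) = q * pow q n

-- 1/n for n ≥ 1 (value at 0 is an unused junk value 0)
inv : ℕ → ℚ
inv zero = 0ℚ
inv (suc n) = + 1 / suc n

-- Bivariate polynomials in (q , t) as lists of monomials (a , i , j) = a·q^i·t^j
Monomial : Set
Monomial = ℚ × ℕ × ℕ

Poly2 : Set
Poly2 = List Monomial

evalMono : Monomial → ℚ → ℚ → ℚ
evalMono (a , i , j) q t = a * pow q i * pow t j

eval : Poly2 → ℚ → ℚ → ℚ
eval [] q t = 0ℚ
eval (m ∷ ms) q t = evalMono m q t + eval ms q t

-- One integration step: given F(q,s) and a part c ≥ 1, the polynomial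
--   G(q,t) = ∫_q^t s^(c-1) F(q,s) ds.
-- For a monomial a q^i s^j:  ∫_q^t a q^i s^(j+c-1) ds
--   = a/(j+c) · q^i t^(j+c) − a/(j+c) · q^(i+j+c).
stepMono : ℕ → Monomial → Poly2
stepMono c (a , i , j) =
  (a * inv (j ℕ.+ c) , i , j ℕ.+ c) ∷ (- (a * inv (j ℕ.+ c)) , i ℕ.+ (j ℕ.+ c) , 0) ∷ []

step : Poly2 → ℕ → Poly2
step F c = concatMap (stepMono c) F

-- F_c(q,t) = ∫_q^t ∫_q^{t_k} ⋯ ∫_q^{t_2} t_1^(c_1-1) ⋯ t_k^(c_k-1) dt_1 ⋯ dt_k
-- (innermost integral corresponds to c_1; empty composition gives 1).
iterInt : List ℕ → Poly2
iterInt c = foldl step ((1ℚ , 0 , 0) ∷ []) c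

g : List ℕ → ℚ → ℚ
g c q = eval (iterInt c) q 1ℚ

{-# OPTIONS --safe #-}
module Submission where

-- Integrating the monomial a·qⁱ·sʲ against s^(c-1) from q to t gives
-- a/(j+c)·qⁱ·(t^(j+c) − q^(j+c)), i.e. a·qⁱ times the first integration of the
-- unit polynomial with exponent j+c.  Since further integrations are linear and
-- commute with multiplication by powers of q, the first two integrations for
-- (c₁, c₂, …) split into 1/c₁ times those for (c₁+c₂, …) minus q^c₁/c₁ times
-- those for (c₂, …).

open import Defs
open import Data.Nat using (ℕ; _≤_)
open import Data.Nat as ℕ using ()
open import Data.Nat.Properties as ℕ using ()
open import Data.List using (List; []; _∷_; _++_; foldl; map; concatMap)
open import Data.List.Properties using (concatMap-++; concatMap-map; map-concatMap; concatMap-cong)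
open import Data.List.Relation.Unary.All using (All)
open import Data.Rational using (ℚ; _*_; _-_; _+_; -_; 1ℚ)
open import Data.Rational.Properties as ℚ using ()
open import Data.Rational.Solver using (module +-*-Solver)
open import Data.Product using (_,_)
open import Function using (_∘_)
open import Relation.Binary.PropositionalEquality

unit : Poly2
unit = (1ℚ , 0 , 0) ∷ []

scaleMono : ℚ → ℕ → Monomial → Monomial
scaleMono r k (a , i , j) = (r * a , i ℕ.+ k , j)

scale : ℚ → ℕ → Poly2 → Poly2
scale r k = map (scaleMono r k)

pow-+ : ∀ q i k → pow q (i ℕ.+ k) ≡ pow q i * pow q k
pow-+ q ℕ.zero    k = sym (ℚ.*-identityˡ (pow q k))
pow-+ q (ℕ.suc i) k = trans (cong (q *_) (pow-+ q i k)) (sym (ℚ.*-assoc q (pow q i) (pow q k)))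

eval-++ : ∀ F G q t → eval (F ++ G) q t ≡ eval F q t + eval G q t
eval-++ []      G q t = sym (ℚ.+-identityˡ (eval G q t))
eval-++ (m ∷ F) G q t = trans (cong (evalMono m q t +_) (eval-++ F G q t))
                              (sym (ℚ.+-assoc (evalMono m q t) (eval F q t) (eval G q t)))

eval-scale : ∀ r k F q t → eval (scale r k F) q t ≡ r * pow q k * eval F q t
eval-scale r k []              q t = sym (ℚ.*-zeroʳ (r * pow q k))
eval-scale r k ((a , i , j) ∷ F) q t
  rewrite eval-scale r k F q t | pow-+ q i k = distrib r a (pow q i) (pow q k) (pow t j) (eval F q t)
  where
  open +-*-Solver
  distrib : ∀ r a x y z e → r * a * (x * y) * z + r * y * e ≡ r * y * (a * x * z + e)
  distrib = solve 6 (λ r a x y z e → r :* a :* (x :* y) :* z :+ r :* y :* e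
                                   := r :* y :* (a :* x :* z :+ e)) refl

eval-foldl-step-++ : ∀ cs F G q t →
  eval (foldl step (F ++ G) cs) q t ≡ eval (foldl step F cs) q t + eval (foldl step G cs) q t
eval-foldl-step-++ []       F G q t = eval-++ F G q t
eval-foldl-step-++ (c ∷ cs) F G q t rewrite concatMap-++ (stepMono c) F G =
  eval-foldl-step-++ cs (step F c) (step G c) q t

stepMono-scaleMono : ∀ c r k m → stepMono c (scaleMono r k m) ≡ scale r k (stepMono c m)
stepMono-scaleMono c r k (a , i , j) =
  cong₂ _∷_ (cong (λ b → b , i ℕ.+ k , j ℕ.+ c) (ℚ.*-assoc r a _))
    (cong₂ _∷_ (cong₂ (λ b e → b , e , 0) coefficient exponent) refl)
  where
  coefficient : - (r * a * inv (j ℕ.+ c)) ≡ r * - (a * inv (j ℕ.+ c))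
  coefficient = trans (cong -_ (ℚ.*-assoc r a _)) (ℚ.neg-distribʳ-* r _)
  exponent : i ℕ.+ k ℕ.+ (j ℕ.+ c) ≡ i ℕ.+ (j ℕ.+ c) ℕ.+ k
  exponent = trans (ℕ.+-assoc i k _) (trans (cong (i ℕ.+_) (ℕ.+-comm k _)) (sym (ℕ.+-assoc i _ k)))

step-scale : ∀ r k F c → step (scale r k F) c ≡ scale r k (step F c)
step-scale r k F c = begin
  step (scale r k F) c                         ≡⟨ concatMap-map (stepMono c) (scaleMono r k) F ⟩
  concatMap (stepMono c ∘ scaleMono r k) F     ≡⟨ concatMap-cong (stepMono-scaleMono c r k) F ⟩
  concatMap (scale r k ∘ stepMono c) F         ≡⟨ map-concatMap (scaleMono r k) (stepMono c) F ⟨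
  scale r k (step F c)                         ∎
  where open ≡-Reasoning

foldl-step-scale : ∀ cs r k F → foldl step (scale r k F) cs ≡ scale r k (foldl step F cs)
foldl-step-scale []       r k F = refl
foldl-step-scale (c ∷ cs) r k F rewrite step-scale r k F c = foldl-step-scale cs r k (step F c)

stepMono≡scale-step-unit : ∀ c a i j → stepMono c (a , i , j) ≡ scale a i (step unit (j ℕ.+ c))
stepMono≡scale-step-unit c a i j =
  cong₂ _∷_ (cong (λ b → b , i , j ℕ.+ c) (cong (a *_) (sym (ℚ.*-identityˡ _))))
    (cong₂ _∷_ (cong₂ (λ b e → b , e , 0) coefficient (ℕ.+-comm i (j ℕ.+ c))) refl)
  where
  coefficient : - (a * inv (j ℕ.+ c)) ≡ a * - (1ℚ * inv (j ℕ.+ c))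
  coefficient = trans (cong (λ x → - (a * x)) (sym (ℚ.*-identityˡ _))) (ℚ.neg-distribʳ-* a _)

eval-foldl-step-stepMono : ∀ cs c a i j q t →
  eval (foldl step (stepMono c (a , i , j)) cs) q t ≡ a * pow q i * eval (iterInt ((j ℕ.+ c) ∷ cs)) q t
eval-foldl-step-stepMono cs c a i j q t = begin
  eval (foldl step (stepMono c (a , i , j)) cs) q t
    ≡⟨ cong (λ F → eval (foldl step F cs) q t) (stepMono≡scale-step-unit c a i j) ⟩
  eval (foldl step (scale a i (step unit (j ℕ.+ c))) cs) q t
    ≡⟨ cong (λ F → eval F q t) (foldl-step-scale cs a i (step unit (j ℕ.+ c))) ⟩
  eval (scale a i (iterInt ((j ℕ.+ c) ∷ cs))) q t
    ≡⟨ eval-scale a i (iterInt ((j ℕ.+ c) ∷ cs)) q t ⟩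
  a * pow q i * eval (iterInt ((j ℕ.+ c) ∷ cs)) q t
    ∎
  where open ≡-Reasoning

-- The positivity hypothesis is not needed: with the junk value inv 0 = 0 both
-- sides vanish when c₁ = 0.
lemma7p2 : (c₁ c₂ : ℕ) (cs : List ℕ) → All (1 ≤_) (c₁ ∷ c₂ ∷ cs) → (q : ℚ) →
    g (c₁ ∷ c₂ ∷ cs) q ≡ inv c₁ * g ((c₁ ℕ.+ c₂) ∷ cs) q - (pow q c₁ * inv c₁) * g (c₂ ∷ cs) q
lemma7p2 c₁ c₂ cs _ q = begin
  g (c₁ ∷ c₂ ∷ cs) q
    ≡⟨ eval-foldl-step-++ cs (stepMono c₂ (s , 0 , c₁)) (stepMono c₂ (- s , c₁ , 0)) q 1ℚ ⟩
  eval (foldl step (stepMono c₂ (s , 0 , c₁)) cs) q 1ℚ + eval (foldl step (stepMono c₂ (- s , c₁ , 0)) cs) q 1ℚ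
    ≡⟨ cong₂ _+_ (eval-foldl-step-stepMono cs c₂ s 0 c₁ q 1ℚ) (eval-foldl-step-stepMono cs c₂ (- s) c₁ 0 q 1ℚ) ⟩
  s * 1ℚ * g ((c₁ ℕ.+ c₂) ∷ cs) q + - s * pow q c₁ * g (c₂ ∷ cs) q
    ≡⟨ regroup (inv c₁) (pow q c₁) (g ((c₁ ℕ.+ c₂) ∷ cs) q) (g (c₂ ∷ cs) q) ⟩
  inv c₁ * g ((c₁ ℕ.+ c₂) ∷ cs) q - (pow q c₁ * inv c₁) * g (c₂ ∷ cs) q
    ∎
  where
  open ≡-Reasoning
  open +-*-Solver
  s : ℚ
  s = 1ℚ * inv c₁
  regroup : ∀ a p u v → 1ℚ * a * 1ℚ * u + - (1ℚ * a) * p * v ≡ a * u - (p * a) * v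
  regroup = solve 4 (λ a p u v → con 1ℚ :* a :* con 1ℚ :* u :+ (:- (con 1ℚ :* a)) :* p :* v
                               := a :* u :- (p :* a) :* v) refl
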